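{- Let $G$ be a graph with $n$ vertices and $m$ edges, and $S(G)$ its subdivision graph. Then, with the invariants on the right evaluated at $G$: $\Theta_1(S(G))=2[M_2^1+M_1^3-M_1^2]$, $\Theta_2(S(G))=M_2^1+2M_1^2-4m$, $\Theta_2^+(S(G))=3M_1^2-4m$, $\Theta_3(S(G))=4M_2^1-2M_1^2$, $\Theta_3^+(S(G))=2M_2^1+M_1^2-4m$, $\Theta_3^{+,2}(S(G))=\alpha_{1,2}+4M_1^2-M_1^3-8m$, $\Theta_4(S(G))=\alpha_{1,2}+8M_1^2-16m$, $\Theta_5(S(G))=4M_1^2+2M_1^4-2M_1^3$, and $\Theta_6(S(G))=4M_2^1+2M_1^3-4M_1^2$.
   Context: $S(G)$ is obtained from $G$ by inserting a new vertex on each edge. $M_1^\alpha=\sum_v\deg(v)^\alpha$; $M_2^1=\sum_{uv\in E}\deg(u)\deg(v)$; $\alpha_{1,2}=\sum_{uv\in E}[\deg(u)\deg(v)^2+\deg(u)^2\deg(v)]$. For a graph $H$, sums over "$uvw$" range over subgraphs of $H$ isomorphic to the path $P_3$ (each once) with middle vertex $v$, sums over "$uvwx$" over subgraphs isomorphic to $P_4$ (each once) with edges $uv,vw,wx$, degrees taken in $H$: $\Theta_1=\sum_{uvw}\deg(u)\deg(v)\deg(w)$, $\Theta_2=\sum_{uvw}\deg(u)\deg(w)$, $\Theta_3=\sum_{uvwx}\deg(u)\deg(x)$, $\Theta_4=\sum_{uvw}[\deg(u)^2\deg(w)+\deg(u)\deg(w)^2]$, $\Theta_5=\sum_{uvw}\deg(v)^2[\deg(u)+\deg(w)]$,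 $\Theta_6=\sum_{uvwx}[\deg(u)\deg(v)+\deg(w)\deg(x)]$, $\Theta_2^+=\sum_{uvw}[\deg(u)+\deg(w)]$, $\Theta_3^+=\sum_{uvwx}[\deg(u)+\deg(x)]$, $\Theta_3^{+,2}=\sum_{uvwx}[\deg(u)^2+\deg(x)^2]$. -}

module Defs where

open import Data.Bool using (Bool; true; false; _∧_; _∨_; not; if_then_else_)
open import Data.Nat using (ℕ; zero; suc; _+_; _*_; _^_; _<ᵇ_; _≡ᵇ_)
open import Data.Fin using (Fin; toℕ; splitAt)
open import Data.Sum using (_⊎_; inj₁; inj₂)
open import Data.Product using (_×_; _,_; proj₁; proj₂)
open import Data.List using (List; length; lookup; map; allFin; filterᵇ; cartesianProduct)
open import Data.Nat.ListAction using (sum)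
open import Relation.Binary.PropositionalEquality using (_≡_; refl)

record Graph (n : ℕ) : Set where
  field
    adj    : Fin n → Fin n → Bool
    sym    : ∀ i j → adj i j ≡ adj j i
    irrefl : ∀ i → adj i i ≡ false
open Graph public

Σv : ∀ {n} → (Fin n → ℕ) → ℕ
Σv {n} f = sum (map f (allFin n))

indicator : Bool → ℕ → ℕ
indicator b x = if b then x else 0

_<F_ : ∀ {n} → Fin n → Fin n → Bool
i <F j = toℕ i <ᵇ toℕ j

_≠F_ : ∀ {n} → Fin n → Fin n → Bool
i ≠F j = not (toℕ i ≡ᵇ toℕ j)

deg : ∀ {n} → Graph n → Fin n → ℕ
deg G v = Σv (λ w → indicator (adj G v w) 1)

edges : ∀ {n} → Graph n → List (Fin n × Fin n)
edges {n} G = filterᵇ (λ p → adj G (proj₁ p) (proj₂ p) ∧ (proj₁ p <F proj₂ p))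
                      (cartesianProduct (allFin n) (allFin n))

size : ∀ {n} → Graph n → ℕ
size G = length (edges G)

Σe : ∀ {n} → (G : Graph n) → (Fin n → Fin n → ℕ) → ℕ
Σe G f = sum (map (λ p → f (proj₁ p) (proj₂ p)) (edges G))

M1 : ∀ {n} → Graph n → ℕ → ℕ
M1 G α = Σv (λ v → deg G v ^ α)

M2 : ∀ {n} → Graph n → ℕ
M2 G = Σe G (λ u v → deg G u * deg G v)

α12 : ∀ {n} → Graph n → ℕ
α12 G = Σe G (λ u v → deg G u * (deg G v ^ 2) + (deg G u ^ 2) * deg G v)

-- Subdivision graph S(G): vertex set Fin (n + m), where the first n
-- vertices are the vertices of G and vertex n + e corresponds to the
-- e-th edge of G (in the list 'edges G').

isEnd : ∀ {n} (G : Graph n) → Fin n → Fin (size G) → Bool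
isEnd G i e = (toℕ (proj₁ (lookup (edges G) e)) ≡ᵇ toℕ i)
            ∨ (toℕ (proj₂ (lookup (edges G) e)) ≡ᵇ toℕ i)

subAdj′ : ∀ {n} (G : Graph n) → Fin n ⊎ Fin (size G) → Fin n ⊎ Fin (size G) → Bool
subAdj′ G (inj₁ i) (inj₁ j) = false
subAdj′ G (inj₁ i) (inj₂ e) = isEnd G i e
subAdj′ G (inj₂ e) (inj₁ i) = isEnd G i e
subAdj′ G (inj₂ e) (inj₂ f) = false

subAdj′-sym : ∀ {n} (G : Graph n) x y → subAdj′ G x y ≡ subAdj′ G y x
subAdj′-sym G (inj₁ i) (inj₁ j) = refl
subAdj′-sym G (inj₁ i) (inj₂ e) = refl
subAdj′-sym G (inj₂ e) (inj₁ i) = refl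
subAdj′-sym G (inj₂ e) (inj₂ f) = refl

subAdj′-irrefl : ∀ {n} (G : Graph n) x → subAdj′ G x x ≡ false
subAdj′-irrefl G (inj₁ i) = refl
subAdj′-irrefl G (inj₂ e) = refl

S : ∀ {n} → (G : Graph n) → Graph (n + size G)
S {n} G = record
  { adj    = λ k l → subAdj′ G (splitAt n k) (splitAt n l)
  ; sym    = λ k l → subAdj′-sym G (splitAt n k) (splitAt n l)
  ; irrefl = λ k → subAdj′-irrefl G (splitAt n k)
  }

-- A P3 subgraph with middle v is the sequence u,v,w (u ≠ w), up to reversal;
-- we pick the representative with u < w.  A P4 subgraph with edges uv,vw,wx
-- is the sequence u,v,w,x of distinct vertices up to reversal; we pick the
-- representative with u < x.  (u≠v, v≠w, w≠x follow from irreflexivity.)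
-- All summands below are invariant under reversal, as in the paper.

ΣP3 : ∀ {N} → Graph N → (Fin N → Fin N → Fin N → ℕ) → ℕ
ΣP3 H f = Σv λ u → Σv λ v → Σv λ w →
  indicator (adj H u v ∧ adj H v w ∧ (u <F w)) (f u v w)

ΣP4 : ∀ {N} → Graph N → (Fin N → Fin N → Fin N → Fin N → ℕ) → ℕ
ΣP4 H f = Σv λ u → Σv λ v → Σv λ w → Σv λ x →
  indicator (adj H u v ∧ adj H v w ∧ adj H w x ∧ (u ≠F w) ∧ (v ≠F x) ∧ (u <F x))
            (f u v w x)

module _ {N : ℕ} (H : Graph N) where
  private d = deg H

  Θ1 Θ2 Θ3 Θ4 Θ5 Θ6 Θ2⁺ Θ3⁺ Θ3⁺² : ℕ
  Θ1   = ΣP3 H λ u v w → d u * d v * d w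
  Θ2   = ΣP3 H λ u v w → d u * d w
  Θ3   = ΣP4 H λ u v w x → d u * d x
  Θ4   = ΣP3 H λ u v w → (d u ^ 2) * d w + d u * (d w ^ 2)
  Θ5   = ΣP3 H λ u v w → (d v ^ 2) * (d u + d w)
  Θ6   = ΣP4 H λ u v w x → d u * d v + d w * d x
  Θ2⁺  = ΣP3 H λ u v w → d u + d w
  Θ3⁺  = ΣP4 H λ u v w x → d u + d x
  Θ3⁺² = ΣP4 H λ u v w x → d u ^ 2 + d x ^ 2

-- In S(G) an original vertex keeps its degree and every edge-vertex has degree 2.
-- A P₃ of S(G) is either i–e–j with e = ij (one per edge of G, weight depending on
-- deg i and deg j) or e–i–f with e ≠ f two edges at i (deg(i) choose 2 of them); a P₄
-- is i–e–j–f with e = ij and f ≠ e another edge at j (deg(j) − 1 of them for each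
-- orientation of e). So every Θ(S(G)) is an edge sum plus a vertex sum of polynomials
-- in the degrees of G, and the handshake identity Σ_{ij∈E} (g(i) + g(j)) = Σ_i deg(i) g(i)
-- together with 2·C(d,2) + d = d² turns these into the Zagreb-type indices of G.

module Submission where

open import Defs renaming (sym to adj-sym)

module _ where

  open import Data.Bool using (Bool; true; false; _∧_; _∨_; not)
  open import Data.Bool.Properties using (∨-zeroʳ; T-≡; T-∧; T?)
  open import Data.Empty using (⊥; ⊥-elim)
  open import Data.Fin using (Fin; toℕ; join; _↑ˡ_; _↑ʳ_) renaming (zero to fzero; suc to fsuc)
  open import Data.Fin.Properties using (splitAt-join; toℕ-↑ˡ; toℕ-↑ʳ; toℕ<n; toℕ-injective)
  open import Data.List
    using (List; []; _∷_; _++_; length; lookup; map; allFin; filterᵇ; cartesianProduct; tabulate)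
  open import Data.List.Properties using (map-tabulate; map-++; map-∘)
  open import Data.List.Membership.Propositional.Properties using (∈-lookup; ∈-filter⁻)
  open import Data.Nat using (ℕ; zero; suc; _+_; _*_; _^_; _<ᵇ_; _≡ᵇ_; _<_; _≤_)
  open import Data.Nat.Combinatorics using (_C_; nC1≡n; nCk+nC[k+1]≡[n+1]C[k+1])
  open import Data.Nat.ListAction as List using ()
  open import Data.Nat.ListAction.Properties using (sum-++)
  open import Data.Nat.Properties
  open import Data.Nat.Tactic.RingSolver using (solve-∀)
  open import Data.Product using (_×_; _,_; proj₁; proj₂)
  open import Data.Sum using (_⊎_; inj₁; inj₂)
  open import Function using (_∘_; Equivalence)
  open import Relation.Binary using (tri<; tri≈; tri>)
  open import Relation.Binary.PropositionalEquality
  open import Algebra.Properties.Semiring.Sum +-*-semiring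
    using (sum; sum-syntax; sum-cong-≗; sum-replicate-zero; ∑-distrib-+; ∑-comm; *-distribˡ-sum)

  open ≡-Reasoning

  private
    variable
      k m n : ℕ

  indicator-∧ : ∀ b c x → indicator (b ∧ c) x ≡ indicator b (indicator c x)
  indicator-∧ true  c x = refl
  indicator-∧ false c x = refl

  indicator-comm : ∀ b c x → indicator b (indicator c x) ≡ indicator c (indicator b x)
  indicator-comm true  c     x = refl
  indicator-comm false true  x = refl
  indicator-comm false false x = refl

  indicator-+ : ∀ b x y → indicator b (x + y) ≡ indicator b x + indicator b y
  indicator-+ true  x y = refl
  indicator-+ false x y = refl

  indicator-*ʳ : ∀ b x → indicator b x ≡ indicator b 1 * x
  indicator-*ʳ true  x = sym (+-identityʳ x)
  indicator-*ʳ false x = refl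

  indicator-zero : ∀ b {x} → x ≡ 0 → indicator b x ≡ 0
  indicator-zero true  x≡0 = x≡0
  indicator-zero false x≡0 = refl

  indicator-∨-disjoint : ∀ b c x → (b ≡ true → c ≡ true → ⊥) →
                         indicator (b ∨ c) x ≡ indicator b x + indicator c x
  indicator-∨-disjoint true  true  x disj = ⊥-elim (disj refl refl)
  indicator-∨-disjoint true  false x disj = sym (+-identityʳ x)
  indicator-∨-disjoint false c     x disj = refl

  ∑-zero : ∀ n → ∑[ i < n ] 0 ≡ 0
  ∑-zero = sum-replicate-zero

  ∑-one : ∀ n → ∑[ i < n ] 1 ≡ n
  ∑-one zero    = refl
  ∑-one (suc n) = cong suc (∑-one n)

  ∑-*ˡ : ∀ c (f : Fin n → ℕ) → ∑[ i < n ] (c * f i) ≡ c * sum f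
  ∑-*ˡ c f = sym (*-distribˡ-sum c f)

  ∑-indicator : ∀ b (f : Fin n → ℕ) → ∑[ i < n ] indicator b (f i) ≡ indicator b (sum f)
  ∑-indicator {n} true  f = refl
  ∑-indicator {n} false f = ∑-zero n

  count : (Fin n → Bool) → ℕ
  count {n} p = ∑[ i < n ] indicator (p i) 1

  ∑-indicator-const : ∀ (p : Fin n → Bool) c → ∑[ i < n ] indicator (p i) c ≡ count p * c
  ∑-indicator-const {n} p c = begin
    ∑[ i < n ] indicator (p i) c        ≡⟨ sum-cong-≗ (λ i → indicator-*ʳ (p i) c) ⟩
    ∑[ i < n ] (indicator (p i) 1 * c)  ≡⟨ sum-cong-≗ (λ i → *-comm (indicator (p i) 1) c) ⟩
    ∑[ i < n ] (c * indicator (p i) 1)  ≡⟨ ∑-*ˡ c (λ i → indicator (p i) 1) ⟩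
    c * count p                         ≡⟨ *-comm c _ ⟩
    count p * c                         ∎

  Σv≡∑ : (f : Fin n → ℕ) → Σv f ≡ sum f
  Σv≡∑ {n} f = trans (cong List.sum (map-tabulate (λ i → i) f)) (sum-tabulate f)
    where
    sum-tabulate : (g : Fin k → ℕ) → List.sum (tabulate g) ≡ sum g
    sum-tabulate {zero}  g = refl
    sum-tabulate {suc k} g = cong (g fzero +_) (sum-tabulate (g ∘ fsuc))

  Σv-cong : {f g : Fin n → ℕ} → (∀ i → f i ≡ g i) → Σv f ≡ Σv g
  Σv-cong {f = f} {g} f≡g = trans (Σv≡∑ f) (trans (sum-cong-≗ f≡g) (sym (Σv≡∑ g)))

  ∑-↑ : ∀ n (f : Fin (n + m) → ℕ) →
        sum f ≡ ∑[ i < n ] f (i ↑ˡ m) + ∑[ e < m ] f (n ↑ʳ e)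
  ∑-↑ zero    f = refl
  ∑-↑ (suc n) f = trans (cong (f fzero +_) (∑-↑ n (f ∘ fsuc))) (sym (+-assoc (f fzero) _ _))

  <⇒<ᵇ≡true : ∀ {x y} → x < y → (x <ᵇ y) ≡ true
  <⇒<ᵇ≡true x<y = Equivalence.to T-≡ (<⇒<ᵇ x<y)

  ≤⇒<ᵇ≡false : ∀ x y → y ≤ x → (x <ᵇ y) ≡ false
  ≤⇒<ᵇ≡false x y y≤x with x <ᵇ y in x<ᵇy
  ... | false = refl
  ... | true  = ⊥-elim (≤⇒≯ y≤x (<ᵇ⇒< x y (Equivalence.from T-≡ x<ᵇy)))

  +-cancelˡ-<ᵇ : ∀ n x y → (n + x <ᵇ n + y) ≡ (x <ᵇ y)
  +-cancelˡ-<ᵇ zero    x y = refl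
  +-cancelˡ-<ᵇ (suc n) x y = +-cancelˡ-<ᵇ n x y

  +-cancelˡ-≡ᵇ : ∀ n x y → (n + x ≡ᵇ n + y) ≡ (x ≡ᵇ y)
  +-cancelˡ-≡ᵇ zero    x y = refl
  +-cancelˡ-≡ᵇ (suc n) x y = +-cancelˡ-≡ᵇ n x y

  _=F_ : Fin n → Fin n → Bool
  i =F j = toℕ i ≡ᵇ toℕ j

  =F-refl : (i : Fin n) → (i =F i) ≡ true
  =F-refl i = Equivalence.to T-≡ (≡⇒≡ᵇ (toℕ i) (toℕ i) refl)

  =F⇒≡ : (i j : Fin n) → (i =F j) ≡ true → toℕ i ≡ toℕ j
  =F⇒≡ i j i=j = ≡ᵇ⇒≡ (toℕ i) (toℕ j) (Equivalence.from T-≡ i=j)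

  =F-sym : (i j : Fin n) → (i =F j) ≡ (j =F i)
  =F-sym i j = ≡ᵇ-sym (toℕ i) (toℕ j)
    where
    ≡ᵇ-sym : ∀ x y → (x ≡ᵇ y) ≡ (y ≡ᵇ x)
    ≡ᵇ-sym zero    zero    = refl
    ≡ᵇ-sym zero    (suc y) = refl
    ≡ᵇ-sym (suc x) zero    = refl
    ≡ᵇ-sym (suc x) (suc y) = ≡ᵇ-sym x y

  <⇒=F≡false : (i j : Fin n) → toℕ i < toℕ j → (j =F i) ≡ false
  <⇒=F≡false i j i<j with j =F i in j=i
  ... | false = refl
  ... | true  = ⊥-elim (<⇒≢ i<j (sym (=F⇒≡ j i j=i)))

  =F-disjoint : (a b i : Fin n) → toℕ a < toℕ b → (a =F i) ≡ true → (b =F i) ≡ true → ⊥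
  =F-disjoint a b i a<b a=i b=i = <⇒≢ a<b (trans (=F⇒≡ a i a=i) (sym (=F⇒≡ b i b=i)))

  ∑-δ : (a : Fin n) (g : Fin n → ℕ) → ∑[ i < n ] indicator (a =F i) (g i) ≡ g a
  ∑-δ {suc n} fzero    g = trans (cong (g fzero +_) (∑-zero n)) (+-identityʳ _)
  ∑-δ {suc n} (fsuc a) g = ∑-δ a (g ∘ fsuc)

  ∑-δ-pair : (a b : Fin n) → toℕ a < toℕ b → (g : Fin n → ℕ) →
             ∑[ i < n ] indicator ((a =F i) ∨ (b =F i)) (g i) ≡ g a + g b
  ∑-δ-pair {n} a b a<b g = begin
    ∑[ i < n ] indicator ((a =F i) ∨ (b =F i)) (g i)
      ≡⟨ sum-cong-≗ (λ i → indicator-∨-disjoint (a =F i) (b =F i) (g i) (=F-disjoint a b i a<b)) ⟩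
    ∑[ i < n ] (indicator (a =F i) (g i) + indicator (b =F i) (g i))
      ≡⟨ ∑-distrib-+ {n} _ _ ⟩
    ∑[ i < n ] indicator (a =F i) (g i) + ∑[ i < n ] indicator (b =F i) (g i)
      ≡⟨ cong₂ _+_ (∑-δ a g) (∑-δ b g) ⟩
    g a + g b ∎

  ∑∑-δ-pair : (a b : Fin n) → toℕ a < toℕ b → (X : Fin n → Fin n → ℕ) →
    ∑[ i < n ] ∑[ j < n ] indicator ((a =F i) ∨ (b =F i)) (indicator ((a =F j) ∨ (b =F j)) (X i j))
    ≡ (X a a + X a b) + (X b a + X b b)
  ∑∑-δ-pair {n} a b a<b X = begin
    ∑[ i < n ] ∑[ j < n ] indicator (a =F i ∨ b =F i) (indicator (a =F j ∨ b =F j) (X i j))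
      ≡⟨ sum-cong-≗ (λ i → ∑-indicator (a =F i ∨ b =F i) (λ j → indicator (a =F j ∨ b =F j) (X i j))) ⟩
    ∑[ i < n ] indicator (a =F i ∨ b =F i) (∑[ j < n ] indicator (a =F j ∨ b =F j) (X i j))
      ≡⟨ sum-cong-≗ (λ i → cong (indicator (a =F i ∨ b =F i)) (∑-δ-pair a b a<b (X i))) ⟩
    ∑[ i < n ] indicator (a =F i ∨ b =F i) (X i a + X i b)
      ≡⟨ ∑-δ-pair a b a<b (λ i → X i a + X i b) ⟩
    (X a a + X a b) + (X b a + X b b) ∎

  ∑∑-δ-pair-ordered : (a b : Fin n) → toℕ a < toℕ b → (Φ : Fin n → Fin n → ℕ) →
    ∑[ i < n ] ∑[ j < n ] indicator ((a =F i) ∨ (b =F i))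
                            (indicator ((a =F j) ∨ (b =F j)) (indicator (i <F j) (Φ i j)))
    ≡ Φ a b
  ∑∑-δ-pair-ordered a b a<b Φ
    rewrite ∑∑-δ-pair a b a<b (λ i j → indicator (i <F j) (Φ i j))
          | ≤⇒<ᵇ≡false (toℕ a) (toℕ a) ≤-refl | ≤⇒<ᵇ≡false (toℕ b) (toℕ b) ≤-refl
          | <⇒<ᵇ≡true a<b | ≤⇒<ᵇ≡false (toℕ b) (toℕ a) (<⇒≤ a<b) = +-identityʳ (Φ a b)

  ∑∑-δ-pair-distinct : (a b : Fin n) → toℕ a < toℕ b → (Ψ : Fin n → Fin n → ℕ) →
    ∑[ i < n ] ∑[ j < n ] indicator ((a =F i) ∨ (b =F i))
                            (indicator ((a =F j) ∨ (b =F j)) (indicator (i ≠F j) (Ψ i j)))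
    ≡ Ψ a b + Ψ b a
  ∑∑-δ-pair-distinct a b a<b Ψ
    rewrite ∑∑-δ-pair a b a<b (λ i j → indicator (i ≠F j) (Ψ i j))
          | =F-refl a | =F-refl b | <⇒=F≡false a b a<b | =F-sym a b | <⇒=F≡false a b a<b
    = cong (Ψ a b +_) (+-identityʳ (Ψ b a))

  count-remove : (p : Fin n → Bool) (e : Fin n) → count (λ f → p f ∧ (e ≠F f)) + indicator (p e) 1 ≡ count p
  count-remove {n} p e = begin
    count (λ f → p f ∧ (e ≠F f)) + indicator (p e) 1
      ≡⟨ cong (count (λ f → p f ∧ (e ≠F f)) +_) (∑-δ e (λ f → indicator (p f) 1)) ⟨
    count (λ f → p f ∧ (e ≠F f)) + ∑[ f < n ] indicator (e =F f) (indicator (p f) 1)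
      ≡⟨ ∑-distrib-+ {n} _ _ ⟨
    ∑[ f < n ] (indicator (p f ∧ (e ≠F f)) 1 + indicator (e =F f) (indicator (p f) 1))
      ≡⟨ sum-cong-≗ (λ f → split (p f) (e =F f)) ⟩
    count p ∎
    where
    split : ∀ c d → indicator (c ∧ not d) 1 + indicator d (indicator c 1) ≡ indicator c 1
    split true  true  = refl
    split true  false = refl
    split false true  = refl
    split false false = refl

  ∑∑-ordered-pairs : (p : Fin n → Bool) (c : ℕ) →
    ∑[ e < n ] ∑[ f < n ] indicator (p e) (indicator (p f) (indicator (e <F f) c)) ≡ (count p C 2) * c
  ∑∑-ordered-pairs {zero}  p c = refl
  ∑∑-ordered-pairs {suc n} p c = begin
    (indicator p₀ (indicator p₀ 0) + ∑[ f < n ] indicator p₀ (indicator (p (fsuc f)) c))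
      + ∑[ e < n ] (indicator (p (fsuc e)) (indicator p₀ 0) + rest e)
      ≡⟨ cong₂ _+_ (cong₂ _+_ (indicator-zero p₀ (indicator-zero p₀ refl))
                              (∑-indicator p₀ (λ f → indicator (p (fsuc f)) c)))
                   (sum-cong-≗ (λ e → cong (_+ rest e) (indicator-zero (p (fsuc e)) (indicator-zero p₀ refl)))) ⟩
    indicator p₀ (∑[ f < n ] indicator (p (fsuc f)) c) + ∑[ e < n ] rest e
      ≡⟨ cong₂ (λ s t → indicator p₀ s + t) (∑-indicator-const (p ∘ fsuc) c)
                                              (∑∑-ordered-pairs (p ∘ fsuc) c) ⟩
    indicator p₀ (count (p ∘ fsuc) * c) + (count (p ∘ fsuc) C 2) * c
      ≡⟨ step p₀ (count (p ∘ fsuc)) ⟩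
    (count p C 2) * c ∎
    where
    p₀ = p fzero

    rest : Fin n → ℕ
    rest e = ∑[ f < n ] indicator (p (fsuc e)) (indicator (p (fsuc f)) (indicator (e <F f) c))

    step : ∀ b k → indicator b (k * c) + (k C 2) * c ≡ ((indicator b 1 + k) C 2) * c
    step false k = refl
    step true  k = begin
      k * c + (k C 2) * c    ≡⟨ *-distribʳ-+ c k (k C 2) ⟨
      (k + k C 2) * c        ≡⟨ cong (λ t → (t + k C 2) * c) (nC1≡n k) ⟨
      (k C 1 + k C 2) * c    ≡⟨ cong (_* c) (nCk+nC[k+1]≡[n+1]C[k+1] k 1) ⟩
      (suc k C 2) * c        ∎

  sum-map-lookup : ∀ {A : Set} (xs : List A) (h : A → ℕ) →
                   ∑[ i < length xs ] h (lookup xs i) ≡ List.sum (map h xs)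
  sum-map-lookup []       h = refl
  sum-map-lookup (x ∷ xs) h = cong (h x +_) (sum-map-lookup xs h)

  sum-map-filterᵇ : ∀ {A : Set} (p : A → Bool) (xs : List A) (h : A → ℕ) →
                    List.sum (map h (filterᵇ p xs)) ≡ List.sum (map (λ x → indicator (p x) (h x)) xs)
  sum-map-filterᵇ p []       h = refl
  sum-map-filterᵇ p (x ∷ xs) h with p x
  ... | true  = cong (h x +_) (sum-map-filterᵇ p xs h)
  ... | false = sum-map-filterᵇ p xs h

  sum-map-cartesianProduct : ∀ {A B : Set} (xs : List A) (ys : List B) (h : A × B → ℕ) →
    List.sum (map h (cartesianProduct xs ys)) ≡ List.sum (map (λ x → List.sum (map (λ y → h (x , y)) ys)) xs)
  sum-map-cartesianProduct []       ys h = refl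
  sum-map-cartesianProduct (x ∷ xs) ys h = begin
    List.sum (map h (map (x ,_) ys ++ cartesianProduct xs ys))
      ≡⟨ cong List.sum (map-++ h (map (x ,_) ys) (cartesianProduct xs ys)) ⟩
    List.sum (map h (map (x ,_) ys) ++ map h (cartesianProduct xs ys))
      ≡⟨ sum-++ (map h (map (x ,_) ys)) _ ⟩
    List.sum (map h (map (x ,_) ys)) + List.sum (map h (cartesianProduct xs ys))
      ≡⟨ cong₂ _+_ (cong List.sum (sym (map-∘ ys))) (sum-map-cartesianProduct xs ys h) ⟩
    List.sum (map (λ y → h (x , y)) ys) + List.sum (map (λ x → List.sum (map (λ y → h (x , y)) ys)) xs) ∎

  end₁ end₂ : (G : Graph n) → Fin (size G) → Fin n
  end₁ G e = proj₁ (lookup (edges G) e)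
  end₂ G e = proj₂ (lookup (edges G) e)

  end₁<end₂ : (G : Graph n) (e : Fin (size G)) → toℕ (end₁ G e) < toℕ (end₂ G e)
  end₁<end₂ {n} G e = <ᵇ⇒< _ _ (proj₂ (Equivalence.to T-∧ edge-selected))
    where
    edge-selected = proj₂ (∈-filter⁻ (T? ∘ λ p → adj G (proj₁ p) (proj₂ p) ∧ (proj₁ p <F proj₂ p))
                                     {xs = cartesianProduct (allFin n) (allFin n)}
                                     (∈-lookup e))

  Σe≡∑ : (G : Graph n) (f : Fin n → Fin n → ℕ) →
         Σe G f ≡ ∑[ e < size G ] f (end₁ G e) (end₂ G e)
  Σe≡∑ G f = sym (sum-map-lookup (edges G) (λ p → f (proj₁ p) (proj₂ p)))

  Σe≡∑∑ : (G : Graph n) (f : Fin n → Fin n → ℕ) →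
          Σe G f ≡ ∑[ a < n ] ∑[ b < n ] indicator (adj G a b ∧ (a <F b)) (f a b)
  Σe≡∑∑ {n} G f = begin
    Σe G f
      ≡⟨ sum-map-filterᵇ _ (cartesianProduct (allFin n) (allFin n)) (λ p → f (proj₁ p) (proj₂ p)) ⟩
    List.sum (map (λ p → summand (proj₁ p) (proj₂ p)) (cartesianProduct (allFin n) (allFin n)))
      ≡⟨ sum-map-cartesianProduct (allFin n) (allFin n) _ ⟩
    Σv (λ a → Σv (summand a))
      ≡⟨ Σv≡∑ (λ a → Σv (summand a)) ⟩
    ∑[ a < n ] Σv (summand a)
      ≡⟨ sum-cong-≗ (λ a → Σv≡∑ (summand a)) ⟩
    ∑[ a < n ] ∑[ b < n ] summand a b ∎
    where
    summand : Fin n → Fin n → ℕ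
    summand a b = indicator (adj G a b ∧ (a <F b)) (f a b)

  Σe-cong : (G : Graph n) {f g : Fin n → Fin n → ℕ} →
            (∀ a b → toℕ a < toℕ b → f a b ≡ g a b) → Σe G f ≡ Σe G g
  Σe-cong G {f} {g} f≡g = begin
    Σe G f                                      ≡⟨ Σe≡∑ G f ⟩
    ∑[ e < size G ] f (end₁ G e) (end₂ G e)     ≡⟨ sum-cong-≗ (λ e → f≡g _ _ (end₁<end₂ G e)) ⟩
    ∑[ e < size G ] g (end₁ G e) (end₂ G e)     ≡⟨ Σe≡∑ G g ⟨
    Σe G g                                      ∎

  Σe-+ : (G : Graph n) (f g : Fin n → Fin n → ℕ) →
         Σe G (λ a b → f a b + g a b) ≡ Σe G f + Σe G g
  Σe-+ G f g = begin
    Σe G (λ a b → f a b + g a b)                   ≡⟨ Σe≡∑ G _ ⟩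
    ∑[ e < size G ] (f (end₁ G e) (end₂ G e) + g (end₁ G e) (end₂ G e))
                                                   ≡⟨ ∑-distrib-+ {size G} _ _ ⟩
    ∑[ e < size G ] f (end₁ G e) (end₂ G e) + ∑[ e < size G ] g (end₁ G e) (end₂ G e)
                                                   ≡⟨ cong₂ _+_ (Σe≡∑ G f) (Σe≡∑ G g) ⟨
    Σe G f + Σe G g                                ∎

  Σe-*ˡ : (G : Graph n) (c : ℕ) (f : Fin n → Fin n → ℕ) → Σe G (λ a b → c * f a b) ≡ c * Σe G f
  Σe-*ˡ G c f = trans (Σe≡∑ G _) (trans (∑-*ˡ {size G} c _) (cong (c *_) (sym (Σe≡∑ G f))))

  Σe-const : (G : Graph n) (c : ℕ) → Σe G (λ _ _ → c) ≡ c * size G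
  Σe-const G c = begin
    Σe G (λ _ _ → c)           ≡⟨ Σe≡∑ G _ ⟩
    ∑[ e < size G ] c          ≡⟨ sum-cong-≗ {size G} (λ _ → *-identityʳ c) ⟨
    ∑[ e < size G ] (c * 1)    ≡⟨ ∑-*ˡ {size G} c (λ _ → 1) ⟩
    c * ∑[ e < size G ] 1      ≡⟨ cong (c *_) (∑-one (size G)) ⟩
    c * size G                 ∎

  indicator-<F-split : (c : Bool) (a b : Fin n) (x : ℕ) → (toℕ a ≡ toℕ b → c ≡ false) →
                       indicator (c ∧ (a <F b)) x + indicator (c ∧ (b <F a)) x ≡ indicator c x
  indicator-<F-split false a b x loop = refl
  indicator-<F-split true a b x loop with <-cmp (toℕ a) (toℕ b)
  ... | tri< a<b _ _
    rewrite <⇒<ᵇ≡true a<b | ≤⇒<ᵇ≡false (toℕ b) (toℕ a) (<⇒≤ a<b) = +-identityʳ x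
  ... | tri≈ _ a≡b _ with () ← loop a≡b
  ... | tri> _ _ b<a
    rewrite <⇒<ᵇ≡true b<a | ≤⇒<ᵇ≡false (toℕ a) (toℕ b) (<⇒≤ b<a) = refl

  Σe-symmetrise : (G : Graph n) (h : Fin n → Fin n → ℕ) →
                  Σe G (λ a b → h a b + h b a) ≡ ∑[ a < n ] ∑[ b < n ] indicator (adj G a b) (h a b)
  Σe-symmetrise {n} G h = begin
    Σe G (λ a b → h a b + h b a)
      ≡⟨ Σe≡∑∑ G _ ⟩
    ∑[ a < n ] ∑[ b < n ] indicator (adj G a b ∧ (a <F b)) (h a b + h b a)
      ≡⟨ sum-cong-≗ (λ a → trans (sum-cong-≗ (λ b → indicator-+ _ (h a b) (h b a))) (∑-distrib-+ {n} _ _)) ⟩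
    ∑[ a < n ] (∑[ b < n ] below a b (h a b) + ∑[ b < n ] below a b (h b a))
      ≡⟨ ∑-distrib-+ {n} _ _ ⟩
    ∑[ a < n ] ∑[ b < n ] below a b (h a b) + ∑[ a < n ] ∑[ b < n ] below a b (h b a)
      ≡⟨ cong (∑[ a < n ] ∑[ b < n ] below a b (h a b) +_) transpose ⟩
    ∑[ a < n ] ∑[ b < n ] below a b (h a b) + ∑[ a < n ] ∑[ b < n ] above a b (h a b)
      ≡⟨ ∑-distrib-+ {n} _ _ ⟨
    ∑[ a < n ] (∑[ b < n ] below a b (h a b) + ∑[ b < n ] above a b (h a b))
      ≡⟨ sum-cong-≗ (λ a → trans (sym (∑-distrib-+ {n} _ _)) (split a)) ⟩
    ∑[ a < n ] ∑[ b < n ] indicator (adj G a b) (h a b) ∎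
    where
    below above : Fin n → Fin n → ℕ → ℕ
    below a b = indicator (adj G a b ∧ (a <F b))
    above a b = indicator (adj G a b ∧ (b <F a))

    transpose : ∑[ a < n ] ∑[ b < n ] below a b (h b a) ≡ ∑[ a < n ] ∑[ b < n ] above a b (h a b)
    transpose = trans (∑-comm (λ a b → below a b (h b a)))
                      (sum-cong-≗ λ b → sum-cong-≗ λ a →
                        cong (λ t → indicator (t ∧ (a <F b)) (h b a)) (adj-sym G a b))

    split : ∀ a → ∑[ b < n ] (below a b (h a b) + above a b (h a b)) ≡ ∑[ b < n ] indicator (adj G a b) (h a b)
    split a = sum-cong-≗ λ b → indicator-<F-split (adj G a b) a b (h a b) (no-loop b)
      where
      no-loop : ∀ b → toℕ a ≡ toℕ b → adj G a b ≡ false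
      no-loop b a≡b with toℕ-injective a≡b
      ... | refl = irrefl G a

  deg≡count : (G : Graph n) (a : Fin n) → deg G a ≡ count (adj G a)
  deg≡count G a = Σv≡∑ (λ b → indicator (adj G a b) 1)

  handshake : (G : Graph n) (g : Fin n → ℕ) → Σe G (λ a b → g a + g b) ≡ ∑[ a < n ] (deg G a * g a)
  handshake {n} G g = begin
    Σe G (λ a b → g a + g b)                           ≡⟨ Σe-symmetrise G (λ a b → g a) ⟩
    ∑[ a < n ] ∑[ b < n ] indicator (adj G a b) (g a)  ≡⟨ sum-cong-≗ (λ a → ∑-indicator-const (adj G a) (g a)) ⟩
    ∑[ a < n ] (count (adj G a) * g a)                 ≡⟨ sum-cong-≗ (λ a → cong (_* g a) (deg≡count G a)) ⟨
    ∑[ a < n ] (deg G a * g a)                         ∎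

  count-isEnd≡deg : (G : Graph n) (i : Fin n) → count (isEnd G i) ≡ deg G i
  count-isEnd≡deg {n} G i = begin
    count (isEnd G i)
      ≡⟨ Σe≡∑ G (λ a b → indicator ((a =F i) ∨ (b =F i)) 1) ⟨
    Σe G (λ a b → indicator ((a =F i) ∨ (b =F i)) 1)
      ≡⟨ Σe-cong G (λ a b a<b → indicator-∨-disjoint (a =F i) (b =F i) 1 (=F-disjoint a b i a<b)) ⟩
    Σe G (λ a b → indicator (a =F i) 1 + indicator (b =F i) 1)
      ≡⟨ handshake G (λ a → indicator (a =F i) 1) ⟩
    ∑[ a < n ] (deg G a * indicator (a =F i) 1)
      ≡⟨ sum-cong-≗ (λ a → δ-summand a) ⟩
    ∑[ a < n ] indicator (i =F a) (deg G a)
      ≡⟨ ∑-δ i (deg G) ⟩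
    deg G i ∎
    where
    δ-summand : ∀ a → deg G a * indicator (a =F i) 1 ≡ indicator (i =F a) (deg G a)
    δ-summand a = begin
      deg G a * indicator (a =F i) 1  ≡⟨ *-comm (deg G a) _ ⟩
      indicator (a =F i) 1 * deg G a  ≡⟨ indicator-*ʳ (a =F i) (deg G a) ⟨
      indicator (a =F i) (deg G a)    ≡⟨ cong (λ t → indicator t (deg G a)) (=F-sym a i) ⟩
      indicator (i =F a) (deg G a)    ∎

  ∑⊎ : (Fin n ⊎ Fin m → ℕ) → ℕ
  ∑⊎ {n} {m} g = ∑[ i < n ] g (inj₁ i) + ∑[ e < m ] g (inj₂ e)

  ∑⊎-cong : {f g : Fin n ⊎ Fin m → ℕ} → (∀ x → f x ≡ g x) → ∑⊎ f ≡ ∑⊎ g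
  ∑⊎-cong f≡g = cong₂ _+_ (sum-cong-≗ (f≡g ∘ inj₁)) (sum-cong-≗ (f≡g ∘ inj₂))

  ∑⊎-vanishing : (g : Fin n ⊎ Fin m → ℕ) → (∀ x → g x ≡ 0) → ∑⊎ g ≡ 0
  ∑⊎-vanishing {n} {m} g g≡0 = cong₂ _+_ (trans (sum-cong-≗ (g≡0 ∘ inj₁)) (∑-zero n))
                                        (trans (sum-cong-≗ (g≡0 ∘ inj₂)) (∑-zero m))

  ∑⊎-inj₁ : (g : Fin n ⊎ Fin m → ℕ) → (∀ e → g (inj₂ e) ≡ 0) → ∑⊎ g ≡ ∑[ i < n ] g (inj₁ i)
  ∑⊎-inj₁ {n} {m} g g₂≡0 = trans (cong (∑[ i < n ] g (inj₁ i) +_) (trans (sum-cong-≗ g₂≡0) (∑-zero m)))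
                                  (+-identityʳ _)

  ∑⊎-inj₂ : (g : Fin n ⊎ Fin m → ℕ) → (∀ i → g (inj₁ i) ≡ 0) → ∑⊎ g ≡ ∑[ e < m ] g (inj₂ e)
  ∑⊎-inj₂ {n} {m} g g₁≡0 = cong (_+ ∑[ e < m ] g (inj₂ e)) (trans (sum-cong-≗ g₁≡0) (∑-zero n))

  Σv-join : ∀ n m (f : Fin (n + m) → ℕ) → Σv f ≡ ∑⊎ (f ∘ join n m)
  Σv-join n m f = trans (Σv≡∑ f) (∑-↑ n f)

  Σv³-join : ∀ n m (f : Fin (n + m) → Fin (n + m) → Fin (n + m) → ℕ) →
    (Σv λ u → Σv λ v → Σv λ w → f u v w)
    ≡ ∑⊎ λ x → ∑⊎ λ y → ∑⊎ λ z → f (join n m x) (join n m y) (join n m z)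
  Σv³-join n m f = trans (Σv-join n m (λ u → Σv λ v → Σv (f u v))) (∑⊎-cong {n} {m} λ x →
                   trans (Σv-join n m (λ v → Σv (f (ι x) v))) (∑⊎-cong {n} {m} λ y →
                   Σv-join n m (f (ι x) (ι y))))
    where
    ι = join n m

  Σv⁴-join : ∀ n m (f : Fin (n + m) → Fin (n + m) → Fin (n + m) → Fin (n + m) → ℕ) →
    (Σv λ u → Σv λ v → Σv λ w → Σv λ x → f u v w x)
    ≡ ∑⊎ λ x → ∑⊎ λ y → ∑⊎ λ z → ∑⊎ λ w → f (join n m x) (join n m y) (join n m z) (join n m w)
  Σv⁴-join n m f = trans (Σv-join n m (λ u → Σv λ v → Σv λ w → Σv (f u v w))) (∑⊎-cong {n} {m} λ x →
                   Σv³-join n m (f (join n m x)))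

  ΣP3-nested : ∀ {N} (H : Graph N) (f : Fin N → Fin N → Fin N → ℕ) →
    ΣP3 H f ≡ Σv λ u → Σv λ v → Σv λ w →
                indicator (adj H u v) (indicator (adj H v w) (indicator (u <F w) (f u v w)))
  ΣP3-nested H f = Σv-cong λ u → Σv-cong λ v → Σv-cong λ w →
    trans (indicator-∧ (adj H u v) _ _) (cong (indicator (adj H u v)) (indicator-∧ (adj H v w) _ _))

  ΣP4-nested : ∀ {N} (H : Graph N) (f : Fin N → Fin N → Fin N → Fin N → ℕ) →
    ΣP4 H f ≡ Σv λ u → Σv λ v → Σv λ w → Σv λ x →
                indicator (adj H u v) (indicator (adj H v w) (indicator (adj H w x)
                  (indicator (u ≠F w) (indicator (v ≠F x) (indicator (u <F x) (f u v w x))))))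
  ΣP4-nested H f = Σv-cong λ u → Σv-cong λ v → Σv-cong λ w → Σv-cong λ x →
    trans (indicator-∧ (adj H u v) _ _) (cong (indicator (adj H u v)) (
    trans (indicator-∧ (adj H v w) _ _) (cong (indicator (adj H v w)) (
    trans (indicator-∧ (adj H w x) _ _) (cong (indicator (adj H w x)) (
    trans (indicator-∧ (u ≠F w) _ _) (cong (indicator (u ≠F w)) (
    indicator-∧ (v ≠F x) _ _))))))))

  -- Paths in the subdivision graph

  module _ (G : Graph n) where

    private
      ι : Fin n ⊎ Fin (size G) → Fin (n + size G)
      ι = join n (size G)

      vanish : (g : Fin n ⊎ Fin (size G) → ℕ) → (∀ x → g x ≡ 0) → ∑⊎ g ≡ 0
      vanish = ∑⊎-vanishing

    degS : Fin n ⊎ Fin (size G) → ℕ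
    degS (inj₁ i) = deg G i
    degS (inj₂ e) = 2

    position : Fin n ⊎ Fin (size G) → ℕ
    position (inj₁ i) = toℕ i
    position (inj₂ e) = n + toℕ e

    adj-S-join : ∀ x y → adj (S G) (ι x) (ι y) ≡ subAdj′ G x y
    adj-S-join x y = cong₂ (subAdj′ G) (splitAt-join n (size G) x) (splitAt-join n (size G) y)

    toℕ-join : ∀ x → toℕ (ι x) ≡ position x
    toℕ-join (inj₁ i) = toℕ-↑ˡ i (size G)
    toℕ-join (inj₂ e) = toℕ-↑ʳ n e

    deg-S-join : ∀ x → deg (S G) (ι x) ≡ degS x
    deg-S-join x = begin
      deg (S G) (ι x)
        ≡⟨ Σv-join n (size G) (λ w → indicator (adj (S G) (ι x) w) 1) ⟩
      ∑⊎ (λ y → indicator (adj (S G) (ι x) (ι y)) 1)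
        ≡⟨ ∑⊎-cong (λ y → cong (λ t → indicator t 1) (adj-S-join x y)) ⟩
      ∑⊎ (λ y → indicator (subAdj′ G x y) 1)
        ≡⟨ neighbours x ⟩
      degS x ∎
      where
      neighbours : ∀ x → ∑⊎ (λ y → indicator (subAdj′ G x y) 1) ≡ degS x
      neighbours (inj₁ i) = trans (∑⊎-inj₂ (λ y → indicator (subAdj′ G (inj₁ i) y) 1) (λ _ → refl))
                                  (count-isEnd≡deg G i)
      neighbours (inj₂ e) = trans (∑⊎-inj₁ (λ y → indicator (subAdj′ G (inj₂ e) y) 1) (λ _ → refl))
                                  (∑-δ-pair _ _ (end₁<end₂ G e) (λ _ → 1))

    module _ (F : ℕ → ℕ → ℕ → ℕ) where

      P3-summand : (x y z : Fin n ⊎ Fin (size G)) → ℕ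
      P3-summand x y z =
        indicator (subAdj′ G x y) (indicator (subAdj′ G y z)
          (indicator (position x <ᵇ position z) (F (degS x) (degS y) (degS z))))

      ΣP3-S≡∑⊎ : ΣP3 (S G) (λ u v w → F (deg (S G) u) (deg (S G) v) (deg (S G) w))
               ≡ ∑⊎ λ x → ∑⊎ λ y → ∑⊎ λ z → P3-summand x y z
      ΣP3-S≡∑⊎ = trans (ΣP3-nested (S G) _) (trans (Σv³-join n (size G) _)
                   (∑⊎-cong λ x → ∑⊎-cong λ y → ∑⊎-cong λ z → pull-back x y z))
        where
        pull-back : ∀ x y z →
          indicator (adj (S G) (ι x) (ι y)) (indicator (adj (S G) (ι y) (ι z))
            (indicator (ι x <F ι z) (F (deg (S G) (ι x)) (deg (S G) (ι y)) (deg (S G) (ι z)))))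
          ≡ P3-summand x y z
        pull-back x y z rewrite adj-S-join x y | adj-S-join y z | toℕ-join x | toℕ-join z
                              | deg-S-join x | deg-S-join y | deg-S-join z = refl

      ∑⊎-P3-summand : (∑⊎ λ x → ∑⊎ λ y → ∑⊎ λ z → P3-summand x y z)
        ≡ ∑[ i < n ] ∑[ e < size G ] ∑[ j < n ] P3-summand (inj₁ i) (inj₂ e) (inj₁ j)
        + ∑[ e < size G ] ∑[ i < n ] ∑[ f < size G ]
            indicator (isEnd G i e) (indicator (isEnd G i f) (indicator (e <F f) (F 2 (deg G i) 2)))
      ∑⊎-P3-summand = cong₂ _+_ (sum-cong-≗ through-edge) (sum-cong-≗ through-vertex)
        where
        through-edge : ∀ i → (∑⊎ λ y → ∑⊎ λ z → P3-summand (inj₁ i) y z)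
                           ≡ ∑[ e < size G ] ∑[ j < n ] P3-summand (inj₁ i) (inj₂ e) (inj₁ j)
        through-edge i =
          trans (∑⊎-inj₂ (λ y → ∑⊎ (P3-summand (inj₁ i) y)) (λ _ → vanish _ λ _ → refl)) (sum-cong-≗ λ e →
                 ∑⊎-inj₁ (P3-summand (inj₁ i) (inj₂ e)) (λ _ → indicator-zero (isEnd G i e) refl))

        through-vertex : ∀ e → (∑⊎ λ y → ∑⊎ λ z → P3-summand (inj₂ e) y z)
          ≡ ∑[ i < n ] ∑[ f < size G ]
              indicator (isEnd G i e) (indicator (isEnd G i f) (indicator (e <F f) (F 2 (deg G i) 2)))
        through-vertex e =
          trans (∑⊎-inj₁ (λ y → ∑⊎ (P3-summand (inj₂ e) y)) (λ _ → vanish _ λ _ → refl)) (sum-cong-≗ λ i →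
          trans (∑⊎-inj₂ (P3-summand (inj₂ e) (inj₁ i)) (λ _ → indicator-zero (isEnd G i e) refl))
                (sum-cong-≗ λ f →
            cong (λ t → indicator (isEnd G i e) (indicator (isEnd G i f) (indicator t (F 2 (deg G i) 2))))
                 (+-cancelˡ-<ᵇ n (toℕ e) (toℕ f))))

      ΣP3-S : ΣP3 (S G) (λ u v w → F (deg (S G) u) (deg (S G) v) (deg (S G) w))
            ≡ Σe G (λ a b → F (deg G a) 2 (deg G b)) + ∑[ i < n ] ((deg G i C 2) * F 2 (deg G i) 2)
      ΣP3-S = trans ΣP3-S≡∑⊎ (trans ∑⊎-P3-summand (cong₂ _+_ centred-at-edges centred-at-vertices))
        where
        centred-at-edges : ∑[ i < n ] ∑[ e < size G ] ∑[ j < n ] P3-summand (inj₁ i) (inj₂ e) (inj₁ j)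
                         ≡ Σe G (λ a b → F (deg G a) 2 (deg G b))
        centred-at-edges = begin
          ∑[ i < n ] ∑[ e < size G ] ∑[ j < n ] P3-summand (inj₁ i) (inj₂ e) (inj₁ j)
            ≡⟨ ∑-comm (λ i e → ∑[ j < n ] P3-summand (inj₁ i) (inj₂ e) (inj₁ j)) ⟩
          ∑[ e < size G ] ∑[ i < n ] ∑[ j < n ] P3-summand (inj₁ i) (inj₂ e) (inj₁ j)
            ≡⟨ sum-cong-≗ (λ e → ∑∑-δ-pair-ordered (end₁ G e) (end₂ G e) (end₁<end₂ G e)
                                                    (λ a b → F (deg G a) 2 (deg G b))) ⟩
          ∑[ e < size G ] F (deg G (end₁ G e)) 2 (deg G (end₂ G e))
            ≡⟨ Σe≡∑ G (λ a b → F (deg G a) 2 (deg G b)) ⟨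
          Σe G (λ a b → F (deg G a) 2 (deg G b)) ∎

        centred-at-vertices : ∑[ e < size G ] ∑[ i < n ] ∑[ f < size G ]
            indicator (isEnd G i e) (indicator (isEnd G i f) (indicator (e <F f) (F 2 (deg G i) 2)))
          ≡ ∑[ i < n ] ((deg G i C 2) * F 2 (deg G i) 2)
        centred-at-vertices = trans (∑-comm (λ e i → ∑[ f < size G ] indicator (isEnd G i e)
                                      (indicator (isEnd G i f) (indicator (e <F f) (F 2 (deg G i) 2)))))
          (sum-cong-≗ λ i → trans (∑∑-ordered-pairs (isEnd G i) (F 2 (deg G i) 2))
                                 (cong (λ k → (k C 2) * F 2 (deg G i) 2) (count-isEnd≡deg G i)))

    module _ (F : ℕ → ℕ → ℕ → ℕ → ℕ) where

      P4-summand : (x y z w : Fin n ⊎ Fin (size G)) → ℕ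
      P4-summand x y z w =
        indicator (subAdj′ G x y) (indicator (subAdj′ G y z) (indicator (subAdj′ G z w)
          (indicator (not (position x ≡ᵇ position z)) (indicator (not (position y ≡ᵇ position w))
            (indicator (position x <ᵇ position w) (F (degS x) (degS y) (degS z) (degS w)))))))

      ΣP4-S≡∑⊎ : ΣP4 (S G) (λ u v w x → F (deg (S G) u) (deg (S G) v) (deg (S G) w) (deg (S G) x))
               ≡ ∑⊎ λ x → ∑⊎ λ y → ∑⊎ λ z → ∑⊎ λ w → P4-summand x y z w
      ΣP4-S≡∑⊎ = trans (ΣP4-nested (S G) _) (trans (Σv⁴-join n (size G) _)
                   (∑⊎-cong λ x → ∑⊎-cong λ y → ∑⊎-cong λ z → ∑⊎-cong λ w → pull-back x y z w))
        where
        pull-back : ∀ x y z w →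
          indicator (adj (S G) (ι x) (ι y)) (indicator (adj (S G) (ι y) (ι z)) (indicator (adj (S G) (ι z) (ι w))
            (indicator (ι x ≠F ι z) (indicator (ι y ≠F ι w) (indicator (ι x <F ι w)
              (F (deg (S G) (ι x)) (deg (S G) (ι y)) (deg (S G) (ι z)) (deg (S G) (ι w))))))))
          ≡ P4-summand x y z w
        pull-back x y z w
          rewrite adj-S-join x y | adj-S-join y z | adj-S-join z w
                | toℕ-join x | toℕ-join y | toℕ-join z | toℕ-join w
                | deg-S-join x | deg-S-join y | deg-S-join z | deg-S-join w = refl

      private
        Φ : Fin n → Fin n → ℕ
        Φ i j = F (deg G i) 2 (deg G j) 2

      -- Only i–e–j–f contributes: the endpoint condition u < x holds automatically there since
      -- original vertices precede edge-vertices, and fails for e–i–f–j.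
      P4-from-vertex : ∀ i → (∑⊎ λ y → ∑⊎ λ z → ∑⊎ (P4-summand (inj₁ i) y z))
        ≡ ∑[ e < size G ] ∑[ j < n ] ∑[ f < size G ]
            indicator (isEnd G i e) (indicator (isEnd G j e) (indicator (isEnd G j f)
              (indicator (i ≠F j) (indicator (e ≠F f) (Φ i j)))))
      P4-from-vertex i =
        trans (∑⊎-inj₂ (λ y → ∑⊎ λ z → ∑⊎ (P4-summand (inj₁ i) y z))
                       (λ _ → vanish _ λ _ → vanish _ λ _ → refl))
        (sum-cong-≗ λ e →
        trans (∑⊎-inj₁ (λ z → ∑⊎ (P4-summand (inj₁ i) (inj₂ e) z))
                       (λ _ → vanish _ λ _ → indicator-zero (isEnd G i e) refl))
        (sum-cong-≗ λ j →
        trans (∑⊎-inj₂ (P4-summand (inj₁ i) (inj₂ e) (inj₁ j))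
                       (λ _ → indicator-zero (isEnd G i e) (indicator-zero (isEnd G j e) refl)))
        (sum-cong-≗ λ f → vertex-edge-vertex-edge e j f)))
        where
        vertex-edge-vertex-edge : ∀ e j f → P4-summand (inj₁ i) (inj₂ e) (inj₁ j) (inj₂ f)
          ≡ indicator (isEnd G i e) (indicator (isEnd G j e) (indicator (isEnd G j f)
              (indicator (i ≠F j) (indicator (e ≠F f) (Φ i j)))))
        vertex-edge-vertex-edge e j f
          rewrite +-cancelˡ-≡ᵇ n (toℕ e) (toℕ f)
                | <⇒<ᵇ≡true (≤-trans (toℕ<n i) (m≤m+n n (toℕ f))) = refl

      ends-before-start : ∀ e i f j → P4-summand (inj₂ e) (inj₁ i) (inj₂ f) (inj₁ j) ≡ 0
      ends-before-start e i f j
        rewrite ≤⇒<ᵇ≡false (n + toℕ e) (toℕ j) (≤-trans (<⇒≤ (toℕ<n j)) (m≤m+n n (toℕ e))) =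
        indicator-zero (isEnd G i e) (indicator-zero (isEnd G i f) (indicator-zero (isEnd G j f)
          (indicator-zero (not (n + toℕ e ≡ᵇ n + toℕ f)) (indicator-zero (not (toℕ i ≡ᵇ toℕ j)) refl))))

      P4-from-edge : ∀ e → (∑⊎ λ y → ∑⊎ λ z → ∑⊎ (P4-summand (inj₂ e) y z)) ≡ 0
      P4-from-edge e = vanish (λ y → ∑⊎ λ z → ∑⊎ (P4-summand (inj₂ e) y z)) λ where
        (inj₂ f) → vanish (λ z → ∑⊎ (P4-summand (inj₂ e) (inj₂ f) z)) λ _ → vanish _ λ _ → refl
        (inj₁ i) → vanish (λ z → ∑⊎ (P4-summand (inj₂ e) (inj₁ i) z)) λ where
          (inj₁ j) → vanish (P4-summand (inj₂ e) (inj₁ i) (inj₁ j)) λ _ →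
                       indicator-zero (isEnd G i e) refl
          (inj₂ f) → vanish (P4-summand (inj₂ e) (inj₁ i) (inj₂ f)) λ where
            (inj₂ g) → indicator-zero (isEnd G i e) (indicator-zero (isEnd G i f) refl)
            (inj₁ j) → ends-before-start e i f j

      ∑⊎-P4-summand : (∑⊎ λ x → ∑⊎ λ y → ∑⊎ λ z → ∑⊎ λ w → P4-summand x y z w)
        ≡ ∑[ i < n ] ∑[ e < size G ] ∑[ j < n ] ∑[ f < size G ]
            indicator (isEnd G i e) (indicator (isEnd G j e) (indicator (isEnd G j f)
              (indicator (i ≠F j) (indicator (e ≠F f) (Φ i j)))))
      ∑⊎-P4-summand = trans (∑⊎-inj₁ (λ x → ∑⊎ λ y → ∑⊎ λ z → ∑⊎ (P4-summand x y z)) P4-from-edge)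
                            (sum-cong-≗ P4-from-vertex)

      private
        other-edges : Fin (size G) → Fin n → ℕ
        other-edges e j = count (λ f → isEnd G j f ∧ (e ≠F f))

        other-edges+1 : ∀ e j → isEnd G j e ≡ true → other-edges e j + 1 ≡ deg G j
        other-edges+1 e j j∈e = begin
          other-edges e j + 1                           ≡⟨ cong (λ t → other-edges e j + indicator t 1) j∈e ⟨
          other-edges e j + indicator (isEnd G j e) 1   ≡⟨ count-remove (isEnd G j) e ⟩
          count (isEnd G j)                             ≡⟨ count-isEnd≡deg G j ⟩
          deg G j                                       ∎

      paths-through-edge : ∀ e →
        ∑[ i < n ] ∑[ j < n ] ∑[ f < size G ]
          indicator (isEnd G i e) (indicator (isEnd G j e) (indicator (isEnd G j f)
            (indicator (i ≠F j) (indicator (e ≠F f) (Φ i j)))))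
        ≡ other-edges e (end₂ G e) * Φ (end₁ G e) (end₂ G e) + other-edges e (end₁ G e) * Φ (end₂ G e) (end₁ G e)
      paths-through-edge e = trans (sum-cong-≗ λ i → sum-cong-≗ λ j → extensions i j)
                                   (∑∑-δ-pair-distinct (end₁ G e) (end₂ G e) (end₁<end₂ G e)
                                                       (λ i j → other-edges e j * Φ i j))
        where
        extensions : ∀ i j →
          ∑[ f < size G ] indicator (isEnd G i e) (indicator (isEnd G j e) (indicator (isEnd G j f)
            (indicator (i ≠F j) (indicator (e ≠F f) (Φ i j)))))
          ≡ indicator (isEnd G i e) (indicator (isEnd G j e) (indicator (i ≠F j) (other-edges e j * Φ i j)))
        extensions i j = begin
          ∑[ f < size G ] indicator (isEnd G i e) (indicator (isEnd G j e) (extension f))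
            ≡⟨ ∑-indicator (isEnd G i e) (λ f → indicator (isEnd G j e) (extension f)) ⟩
          indicator (isEnd G i e) (∑[ f < size G ] indicator (isEnd G j e) (extension f))
            ≡⟨ cong (indicator (isEnd G i e)) (∑-indicator (isEnd G j e) extension) ⟩
          indicator (isEnd G i e) (indicator (isEnd G j e) (∑[ f < size G ] extension f))
            ≡⟨ cong (λ t → indicator (isEnd G i e) (indicator (isEnd G j e) t)) count-extensions ⟩
          indicator (isEnd G i e) (indicator (isEnd G j e) (indicator (i ≠F j) (other-edges e j * Φ i j))) ∎
          where
          extension : Fin (size G) → ℕ
          extension f = indicator (isEnd G j f) (indicator (i ≠F j) (indicator (e ≠F f) (Φ i j)))

          count-extensions : ∑[ f < size G ] extension f ≡ indicator (i ≠F j) (other-edges e j * Φ i j)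
          count-extensions = begin
            ∑[ f < size G ] extension f
              ≡⟨ sum-cong-≗ (λ f → trans (indicator-comm (isEnd G j f) (i ≠F j) _)
                                         (cong (indicator (i ≠F j)) (sym (indicator-∧ (isEnd G j f) (e ≠F f) _)))) ⟩
            ∑[ f < size G ] indicator (i ≠F j) (indicator (isEnd G j f ∧ (e ≠F f)) (Φ i j))
              ≡⟨ ∑-indicator (i ≠F j) (λ f → indicator (isEnd G j f ∧ (e ≠F f)) (Φ i j)) ⟩
            indicator (i ≠F j) (∑[ f < size G ] indicator (isEnd G j f ∧ (e ≠F f)) (Φ i j))
              ≡⟨ cong (indicator (i ≠F j)) (∑-indicator-const (λ f → isEnd G j f ∧ (e ≠F f)) (Φ i j)) ⟩
            indicator (i ≠F j) (other-edges e j * Φ i j) ∎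

      -- The edge sum is moved to the left so that deg − 1 (truncated in ℕ) never appears.
      ΣP4-S : ΣP4 (S G) (λ u v w x → F (deg (S G) u) (deg (S G) v) (deg (S G) w) (deg (S G) x))
                + Σe G (λ a b → F (deg G a) 2 (deg G b) 2 + F (deg G b) 2 (deg G a) 2)
            ≡ Σe G (λ a b → deg G b * F (deg G a) 2 (deg G b) 2 + deg G a * F (deg G b) 2 (deg G a) 2)
      ΣP4-S = begin
        ΣP4 (S G) _ + Σe G (λ a b → Φ a b + Φ b a)
          ≡⟨ cong₂ _+_ (trans ΣP4-S≡∑⊎ (trans ∑⊎-P4-summand
                         (trans (∑-comm {n} {size G} _) (sum-cong-≗ paths-through-edge))))
                       (Σe≡∑ G (λ a b → Φ a b + Φ b a)) ⟩
        ∑[ e < size G ] (other-edges e (b e) * Φ (a e) (b e) + other-edges e (a e) * Φ (b e) (a e))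
          + ∑[ e < size G ] (Φ (a e) (b e) + Φ (b e) (a e))
          ≡⟨ ∑-distrib-+ {size G} _ _ ⟨
        ∑[ e < size G ] ((other-edges e (b e) * Φ (a e) (b e) + other-edges e (a e) * Φ (b e) (a e))
                          + (Φ (a e) (b e) + Φ (b e) (a e)))
          ≡⟨ sum-cong-≗ (λ e → count-ends e) ⟩
        ∑[ e < size G ] (deg G (b e) * Φ (a e) (b e) + deg G (a e) * Φ (b e) (a e))
          ≡⟨ Σe≡∑ G (λ a b → deg G b * Φ a b + deg G a * Φ b a) ⟨
        Σe G (λ a b → deg G b * Φ a b + deg G a * Φ b a) ∎
        where
        a b : Fin (size G) → Fin n
        a = end₁ G
        b = end₂ G

        a∈e : ∀ e → isEnd G (a e) e ≡ true
        a∈e e rewrite =F-refl (a e) = refl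

        b∈e : ∀ e → isEnd G (b e) e ≡ true
        b∈e e rewrite =F-refl (b e) = ∨-zeroʳ (a e =F b e)

        absorb : ∀ {Ka Kb da db} x y → Ka + 1 ≡ da → Kb + 1 ≡ db →
                 (Kb * x + Ka * y) + (x + y) ≡ db * x + da * y
        absorb {Ka} {Kb} x y refl refl = identity Ka Kb x y
          where
          identity : ∀ Ka Kb x y → (Kb * x + Ka * y) + (x + y) ≡ (Kb + 1) * x + (Ka + 1) * y
          identity = solve-∀

        count-ends : ∀ e → (other-edges e (b e) * Φ (a e) (b e) + other-edges e (a e) * Φ (b e) (a e))
                             + (Φ (a e) (b e) + Φ (b e) (a e))
                         ≡ deg G (b e) * Φ (a e) (b e) + deg G (a e) * Φ (b e) (a e)
        count-ends e = absorb _ _ (other-edges+1 e (a e) (a∈e e)) (other-edges+1 e (b e) (b∈e e))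

  -- Degree sums

  choose₂-double : ∀ k → 2 * (k C 2) + k ≡ k * k
  choose₂-double zero    = refl
  choose₂-double (suc k) = begin
    2 * (suc k C 2) + suc k            ≡⟨ cong (λ t → 2 * t + suc k) (nCk+nC[k+1]≡[n+1]C[k+1] k 1) ⟨
    2 * (k C 1 + k C 2) + suc k        ≡⟨ cong (λ t → 2 * (t + k C 2) + suc k) (nC1≡n k) ⟩
    2 * (k + k C 2) + suc k            ≡⟨ expand k (k C 2) ⟩
    (2 * (k C 2) + k) + (2 * k + 1)    ≡⟨ cong (_+ (2 * k + 1)) (choose₂-double k) ⟩
    k * k + (2 * k + 1)                ≡⟨ square k ⟩
    suc k * suc k                      ∎
    where
    expand : ∀ k c → 2 * (k + c) + suc k ≡ (2 * c + k) + (2 * k + 1)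
    expand = solve-∀
    square : ∀ k → k * k + (2 * k + 1) ≡ suc k * suc k
    square = solve-∀

  -- Identities that only hold modulo 2·C(k,2) + k = k² are proved by writing both sides
  -- as E applied to one of these two expressions.
  via-choose₂ : ∀ (E : ℕ → ℕ) k {L R} → L ≡ E (2 * (k C 2) + k) → E (k * k) ≡ R → L ≡ R
  via-choose₂ E k L≡ ≡R = trans L≡ (trans (cong E (choose₂-double k)) ≡R)

  module _ (G : Graph n) where

    private
      d = deg G

    M1≡∑ : ∀ k → M1 G k ≡ ∑[ i < n ] (d i ^ k)
    M1≡∑ k = Σv≡∑ (λ i → d i ^ k)

    Σe-power-sum : ∀ k → Σe G (λ a b → d a ^ k + d b ^ k) ≡ M1 G (suc k)
    Σe-power-sum k = trans (handshake G (λ a → d a ^ k)) (sym (M1≡∑ (suc k)))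

    Σe-deg : Σe G (λ a b → d a + d b) ≡ M1 G 2
    Σe-deg = trans (Σe-cong G λ a b _ → sym (cong₂ _+_ (*-identityʳ (d a)) (*-identityʳ (d b))))
                   (Σe-power-sum 1)

    double-size : 2 * size G ≡ M1 G 1
    double-size = trans (sym (Σe-const G 2)) (Σe-power-sum 0)

    choose₂-sum : (X : ℕ → ℕ) (c k c′ k′ : ℕ) → (∀ x → (x C 2) * X x + c * x ^ k ≡ c′ * x ^ k′) →
                  ∑[ i < n ] ((d i C 2) * X (d i)) + c * M1 G k ≡ c′ * M1 G k′
    choose₂-sum X c k c′ k′ pointwise = begin
      ∑[ i < n ] ((d i C 2) * X (d i)) + c * M1 G k
        ≡⟨ cong (λ t → ∑[ i < n ] ((d i C 2) * X (d i)) + c * t) (M1≡∑ k) ⟩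
      ∑[ i < n ] ((d i C 2) * X (d i)) + c * ∑[ i < n ] (d i ^ k)
        ≡⟨ cong (∑[ i < n ] ((d i C 2) * X (d i)) +_) (∑-*ˡ c (λ i → d i ^ k)) ⟨
      ∑[ i < n ] ((d i C 2) * X (d i)) + ∑[ i < n ] (c * d i ^ k)
        ≡⟨ ∑-distrib-+ {n} _ _ ⟨
      ∑[ i < n ] ((d i C 2) * X (d i) + c * d i ^ k)
        ≡⟨ sum-cong-≗ (pointwise ∘ d) ⟩
      ∑[ i < n ] (c′ * d i ^ k′)
        ≡⟨ ∑-*ˡ c′ (λ i → d i ^ k′) ⟩
      c′ * ∑[ i < n ] (d i ^ k′)
        ≡⟨ cong (c′ *_) (M1≡∑ k′) ⟨
      c′ * M1 G k′ ∎

    private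
      regroup : ∀ {x e v p e′ v′} → x ≡ e + v → e ≡ e′ → v + p ≡ v′ → x + p ≡ e′ + v′
      regroup {e = e} {v} {p} refl refl v+p≡v′ = trans (+-assoc e v p) (cong (e +_) v+p≡v′)

      rewrite-sides : ∀ {x s r p q} → x + s ≡ r → s ≡ p → r ≡ q → x + p ≡ q
      rewrite-sides x+s≡r refl refl = x+s≡r

      choose₂-scaled-4 : ∀ x → (x C 2) * 4 + 2 * x ^ 1 ≡ 2 * x ^ 2
      choose₂-scaled-4 x = via-choose₂ (λ t → 2 * t) x (lhs (x C 2) x) (rhs x)
        where
        lhs : ∀ c x → c * 4 + 2 * (x * 1) ≡ 2 * (2 * c + x)
        lhs = solve-∀
        rhs : ∀ x → 2 * (x * x) ≡ 2 * (x * (x * 1))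
        rhs = solve-∀

      quadruple-size : 4 * size G ≡ 2 * M1 G 1
      quadruple-size = trans (*-assoc 2 2 (size G)) (cong (2 *_) double-size)

      choose₂-sum-4 : ∑[ i < n ] ((d i C 2) * 4) + 4 * size G ≡ 2 * M1 G 2
      choose₂-sum-4 = trans (cong (∑[ i < n ] ((d i C 2) * 4) +_) quadruple-size)
                             (choose₂-sum (λ _ → 4) 2 1 2 2 choose₂-scaled-4)

    Θ1-S : Θ1 (S G) + 2 * M1 G 2 ≡ 2 * M2 G + 2 * M1 G 3
    Θ1-S = regroup (ΣP3-S G (λ p q r → p * q * r))
                   (trans (Σe-cong G (λ a b _ → edge (d a) (d b))) (Σe-*ˡ G 2 _))
                   (choose₂-sum (λ x → 2 * x * 2) 2 2 2 3 vertex)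
      where
      edge : ∀ x y → x * 2 * y ≡ 2 * (x * y)
      edge = solve-∀
      vertex : ∀ x → (x C 2) * (2 * x * 2) + 2 * x ^ 2 ≡ 2 * x ^ 3
      vertex x = via-choose₂ (λ t → 2 * x * t) x (lhs (x C 2) x) (rhs x)
        where
        lhs : ∀ c x → c * (2 * x * 2) + 2 * (x * (x * 1)) ≡ 2 * x * (2 * c + x)
        lhs = solve-∀
        rhs : ∀ x → 2 * x * (x * x) ≡ 2 * (x * (x * (x * 1)))
        rhs = solve-∀

    Θ2-S : Θ2 (S G) + 4 * size G ≡ M2 G + 2 * M1 G 2
    Θ2-S = regroup (ΣP3-S G (λ p q r → p * r)) (refl {x = M2 G}) choose₂-sum-4

    Θ2⁺-S : Θ2⁺ (S G) + 4 * size G ≡ 3 * M1 G 2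
    Θ2⁺-S = trans (regroup (ΣP3-S G (λ p q r → p + r)) Σe-deg choose₂-sum-4) (triple (M1 G 2))
      where
      triple : ∀ x → x + 2 * x ≡ 3 * x
      triple = solve-∀

    Θ4-S : Θ4 (S G) + 16 * size G ≡ α12 G + 8 * M1 G 2
    Θ4-S = regroup (ΣP3-S G (λ p q r → (p ^ 2) * r + p * (r ^ 2)))
                   (Σe-cong G (λ a b _ → +-comm ((d a ^ 2) * d b) (d a * (d b ^ 2))))
                   (trans (cong (∑[ i < n ] ((d i C 2) * 16) +_) sixteen-size)
                          (choose₂-sum (λ _ → 16) 8 1 8 2 vertex))
      where
      sixteen-size : 16 * size G ≡ 8 * M1 G 1
      sixteen-size = trans (*-assoc 8 2 (size G)) (cong (8 *_) double-size)
      vertex : ∀ x → (x C 2) * 16 + 8 * x ^ 1 ≡ 8 * x ^ 2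
      vertex x = via-choose₂ (λ t → 8 * t) x (lhs (x C 2) x) (rhs x)
        where
        lhs : ∀ c x → c * 16 + 8 * (x * 1) ≡ 8 * (2 * c + x)
        lhs = solve-∀
        rhs : ∀ x → 8 * (x * x) ≡ 8 * (x * (x * 1))
        rhs = solve-∀

    Θ5-S : Θ5 (S G) + 2 * M1 G 3 ≡ 4 * M1 G 2 + 2 * M1 G 4
    Θ5-S = regroup (ΣP3-S G (λ p q r → (q ^ 2) * (p + r)))
                   (trans (Σe-*ˡ G 4 _) (cong (4 *_) Σe-deg))
                   (choose₂-sum (λ x → (x ^ 2) * 4) 2 3 2 4 vertex)
      where
      vertex : ∀ x → (x C 2) * ((x ^ 2) * 4) + 2 * x ^ 3 ≡ 2 * x ^ 4
      vertex x = via-choose₂ (λ t → 2 * x * x * t) x (lhs (x C 2) x) (rhs x)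
        where
        lhs : ∀ c x → c * ((x * (x * 1)) * 4) + 2 * (x * (x * (x * 1))) ≡ 2 * x * x * (2 * c + x)
        lhs = solve-∀
        rhs : ∀ x → 2 * x * x * (x * x) ≡ 2 * (x * (x * (x * (x * 1))))
        rhs = solve-∀

    Θ3-S : Θ3 (S G) + 2 * M1 G 2 ≡ 4 * M2 G
    Θ3-S = rewrite-sides (ΣP4-S G (λ p q r s → p * s))
             (trans (Σe-cong G (λ a b _ → ends (d a) (d b))) (trans (Σe-*ˡ G 2 _) (cong (2 *_) Σe-deg)))
             (trans (Σe-cong G (λ a b _ → middles (d a) (d b))) (Σe-*ˡ G 4 _))
      where
      ends : ∀ x y → x * 2 + y * 2 ≡ 2 * (x + y)
      ends = solve-∀
      middles : ∀ x y → y * (x * 2) + x * (y * 2) ≡ 4 * (x * y)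
      middles = solve-∀

    Θ3⁺-S : Θ3⁺ (S G) + (M1 G 2 + 4 * size G) ≡ 2 * M2 G + 2 * M1 G 2
    Θ3⁺-S = rewrite-sides (ΣP4-S G (λ p q r s → p + s))
              (trans (Σe-cong G (λ a b _ → ends (d a) (d b)))
                     (trans (Σe-+ G _ _) (cong₂ _+_ Σe-deg (Σe-const G 4))))
              (trans (Σe-cong G (λ a b _ → middles (d a) (d b)))
                     (trans (Σe-+ G _ _) (cong₂ _+_ (Σe-*ˡ G 2 _) (trans (Σe-*ˡ G 2 _) (cong (2 *_) Σe-deg)))))
      where
      ends : ∀ x y → (x + 2) + (y + 2) ≡ (x + y) + 4
      ends = solve-∀
      middles : ∀ x y → y * (x + 2) + x * (y + 2) ≡ 2 * (x * y) + 2 * (x + y)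
      middles = solve-∀

    Θ3⁺²-S : Θ3⁺² (S G) + (M1 G 3 + 8 * size G) ≡ α12 G + 4 * M1 G 2
    Θ3⁺²-S = rewrite-sides (ΣP4-S G (λ p q r s → p ^ 2 + s ^ 2))
               (trans (Σe-cong G (λ a b _ → ends (d a) (d b)))
                      (trans (Σe-+ G _ _) (cong₂ _+_ (Σe-power-sum 2) (Σe-const G 8))))
               (trans (Σe-cong G (λ a b _ → middles (d a) (d b)))
                      (trans (Σe-+ G _ _) (cong (α12 G +_) (trans (Σe-*ˡ G 4 _) (cong (4 *_) Σe-deg)))))
      where
      ends : ∀ x y → (x * (x * 1) + 4) + (y * (y * 1) + 4) ≡ (x * (x * 1) + y * (y * 1)) + 8
      ends = solve-∀
      middles : ∀ x y → y * (x * (x * 1) + 4) + x * (y * (y * 1) + 4)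
                      ≡ (x * (y * (y * 1)) + (x * (x * 1)) * y) + 4 * (x + y)
      middles = solve-∀

    Θ6-S : Θ6 (S G) + 4 * M1 G 2 ≡ 4 * M2 G + 2 * M1 G 3
    Θ6-S = rewrite-sides (ΣP4-S G (λ p q r s → p * q + r * s))
             (trans (Σe-cong G (λ a b _ → ends (d a) (d b))) (trans (Σe-*ˡ G 4 _) (cong (4 *_) Σe-deg)))
             (trans (Σe-cong G (λ a b _ → middles (d a) (d b)))
                    (trans (Σe-+ G _ _) (cong₂ _+_ (Σe-*ˡ G 4 _)
                                                 (trans (Σe-*ˡ G 2 _) (cong (2 *_) (Σe-power-sum 2))))))
      where
      ends : ∀ x y → (x * 2 + y * 2) + (y * 2 + x * 2) ≡ 4 * (x + y)
      ends = solve-∀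
      middles : ∀ x y → y * (x * 2 + y * 2) + x * (y * 2 + x * 2) ≡ 4 * (x * y) + 2 * (x * (x * 1) + y * (y * 1))
      middles = solve-∀

open import Data.Nat as ℕ using (ℕ)
open import Data.Integer using (ℤ; +_; _+_; _-_; _*_)
open import Data.Integer.Properties using (pos-*)
open import Data.Integer.Tactic.RingSolver using (solve-∀)
open import Data.Product using (_×_; _,_)
open import Relation.Binary.PropositionalEquality using (_≡_; refl; trans; cong; cong₂)

ℕ-sum⇒ℤ-difference : ∀ {L P Q} {p q : ℤ} → L ℕ.+ P ≡ Q → + Q ≡ q → + P ≡ p → + L ≡ q - p
ℕ-sum⇒ℤ-difference {L} {P} refl refl refl = cancel (+ L) (+ P)
  where
  cancel : ∀ x y → x ≡ x + y - y
  cancel = solve-∀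

lemma2p21 : (n : ℕ) (G : Graph n) →
    (+ Θ1 (S G) ≡ + 2 * (+ M2 G + + M1 G 3 - + M1 G 2))
    × (+ Θ2 (S G) ≡ + M2 G + + 2 * + M1 G 2 - + 4 * + size G)
    × (+ Θ2⁺ (S G) ≡ + 3 * + M1 G 2 - + 4 * + size G)
    × (+ Θ3 (S G) ≡ + 4 * + M2 G - + 2 * + M1 G 2)
    × (+ Θ3⁺ (S G) ≡ + 2 * + M2 G + + M1 G 2 - + 4 * + size G)
    × (+ Θ3⁺² (S G) ≡ + α12 G + + 4 * + M1 G 2 - + M1 G 3 - + 8 * + size G)
    × (+ Θ4 (S G) ≡ + α12 G + + 8 * + M1 G 2 - + 16 * + size G)
    × (+ Θ5 (S G) ≡ + 4 * + M1 G 2 + + 2 * + M1 G 4 - + 2 * + M1 G 3)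
    × (+ Θ6 (S G) ≡ + 4 * + M2 G + + 2 * + M1 G 3 - + 4 * + M1 G 2)
lemma2p21 n G =
    trans (ℕ-sum⇒ℤ-difference (Θ1-S G) (cong₂ _+_ (pos-* 2 μ) (pos-* 2 p₃)) (pos-* 2 p₂))
          (factor-two (+ μ) (+ p₃) (+ p₂))
  , ℕ-sum⇒ℤ-difference (Θ2-S G) (cong (_+_ (+ μ)) (pos-* 2 p₂)) (pos-* 4 m)
  , ℕ-sum⇒ℤ-difference (Θ2⁺-S G) (pos-* 3 p₂) (pos-* 4 m)
  , ℕ-sum⇒ℤ-difference (Θ3-S G) (pos-* 4 μ) (pos-* 2 p₂)
  , trans (ℕ-sum⇒ℤ-difference (Θ3⁺-S G) (cong₂ _+_ (pos-* 2 μ) (pos-* 2 p₂)) (cong (_+_ (+ p₂)) (pos-* 4 m)))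
          (cancel-p₂ (+ μ) (+ p₂) (+ m))
  , trans (ℕ-sum⇒ℤ-difference (Θ3⁺²-S G) (cong (_+_ (+ α)) (pos-* 4 p₂)) (cong (_+_ (+ p₃)) (pos-* 8 m)))
          (split-difference (+ α + + 4 * + p₂) (+ p₃) (+ 8 * + m))
  , ℕ-sum⇒ℤ-difference (Θ4-S G) (cong (_+_ (+ α)) (pos-* 8 p₂)) (pos-* 16 m)
  , ℕ-sum⇒ℤ-difference (Θ5-S G) (cong₂ _+_ (pos-* 4 p₂) (pos-* 2 p₄)) (pos-* 2 p₃)
  , ℕ-sum⇒ℤ-difference (Θ6-S G) (cong₂ _+_ (pos-* 4 μ) (pos-* 2 p₃)) (pos-* 4 p₂)
  where
  μ p₂ p₃ p₄ m α : ℕ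
  μ = M2 G
  p₂ = M1 G 2
  p₃ = M1 G 3
  p₄ = M1 G 4
  m = size G
  α = α12 G

  factor-two : ∀ x y z → + 2 * x + + 2 * y - + 2 * z ≡ + 2 * (x + y - z)
  factor-two = solve-∀
  cancel-p₂ : ∀ x y z → + 2 * x + + 2 * y - (y + + 4 * z) ≡ + 2 * x + y - + 4 * z
  cancel-p₂ = solve-∀
  split-difference : ∀ x y z → x - (y + z) ≡ x - y - z
  split-difference = solve-∀
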